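{- Let $s$ be a positive integer and let $\Delta(s)$ be the $n\times n$ matrix with $\Delta(s)_{ij}=1$ if $i=j+s$ and $0$ otherwise. For an $n\times n$ matrix $M$ define $s^+(M)=M-\Delta(s)M\Delta(s)^T$ and $s^-(M)=M-\Delta(s)^TM\Delta(s)$. Then for any $n\times n$ matrices $M$ and $\tilde{M}$, \[ n^{ -2}\|M-\tilde{M}\|_F\le\|s^+(M)-s^+(\tilde{M})\|_F\le n^2\|M-\tilde{M}\|_F, \] and similarly \[ n^{ -2}\|M-\tilde{M}\|_F\le\|s^-(M)-s^-(\tilde{M})\|_F\le n^2\|M-\tilde{M}\|_F. \] -}

module Defs where

open import Level using (Level; _⊔_; suc)
open import Data.Nat as ℕ using (ℕ; zero) renaming (suc to 1+)
open import Data.Fin using (Fin; toℕ) renaming (zero to fz; suc to fs)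
open import Data.Bool using (if_then_else_)
open import Relation.Nullary.Decidable using (⌊_⌋)
open import Relation.Binary.Core using (Rel)
open import Relation.Binary.Structures using (IsTotalOrder)
open import Algebra.Bundles using (CommutativeRing)

record OrderedCommutativeRing (c ℓ₁ ℓ₂ : Level) : Set (suc (c ⊔ ℓ₁ ⊔ ℓ₂)) where
  field
    commutativeRing : CommutativeRing c ℓ₁
  open CommutativeRing commutativeRing public
  field
    _≤_          : Rel Carrier ℓ₂
    isTotalOrder : IsTotalOrder _≈_ _≤_
    +-mono-≤     : ∀ {x y} z → x ≤ y → (x + z) ≤ (y + z)
    *-nonneg     : ∀ {x y} → 0# ≤ x → 0# ≤ y → 0# ≤ (x * y)

module Matrices {c ℓ₁ ℓ₂} (R : OrderedCommutativeRing c ℓ₁ ℓ₂) where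
  open OrderedCommutativeRing R

  Mat : ℕ → Set c
  Mat n = Fin n → Fin n → Carrier

  ∑ : ∀ {n} → (Fin n → Carrier) → Carrier
  ∑ {zero} f = 0#
  ∑ {1+ n} f = f fz + ∑ (λ i → f (fs i))

  ℕ→R : ℕ → Carrier
  ℕ→R zero = 0#
  ℕ→R (1+ k) = 1# + ℕ→R k

  _⊗_ : ∀ {n} → Mat n → Mat n → Mat n
  (A ⊗ B) i j = ∑ (λ k → A i k * B k j)

  _⊖_ : ∀ {n} → Mat n → Mat n → Mat n
  (A ⊖ B) i j = A i j - B i j

  transpose : ∀ {n} → Mat n → Mat n
  transpose A i j = A j i

  -- Δ(s)_{ij} = 1 if i = j + s, 0 otherwise (indices counted from 0; the
  -- condition i = j + s is shift-invariant so this matches 1-based indexing)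
  Δ : ∀ {n} → ℕ → Mat n
  Δ s i j = if ⌊ toℕ i ℕ.≟ toℕ j ℕ.+ s ⌋ then 1# else 0#

  s⁺ : ∀ {n} → ℕ → Mat n → Mat n
  s⁺ s M = M ⊖ ((Δ s ⊗ M) ⊗ transpose (Δ s))

  s⁻ : ∀ {n} → ℕ → Mat n → Mat n
  s⁻ s M = M ⊖ ((transpose (Δ s) ⊗ M) ⊗ Δ s)

  frob² : ∀ {n} → Mat n → Carrier
  frob² A = ∑ (λ i → ∑ (λ j → A i j * A i j))

-- Write D = M − M̃.  Conjugation by Δ(s) (or by Δ(s)ᵀ) is linear and moves every entry by
-- s places along the diagonal, so each entry of s^±(M) − s^±(M̃) is either D i j or
-- D i j − D i' j', where row i' lies strictly before row i in the direction of the shift.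
-- The upper bound is then (a − b)² ≤ 4‖D‖² ≤ n²‖D‖² per entry.  For the lower bound, D i j
-- telescopes into at most n entries of the difference L, which gives D i j² ≤ n²‖L‖² by an
-- induction on the position of the row.  Summing the n² entry bounds gives the factor n⁴.
module Submission where

open import Defs
open import Level using (_⊔_)
open import Data.Nat using (ℕ; _^_) renaming (_<_ to _<ℕ_)
import Data.Nat as ℕ
import Data.Nat.Properties as ℕ
open import Data.Fin using (Fin; toℕ) renaming (zero to fz; suc to fs)
import Data.Fin.Properties as Fin
open import Data.Bool using (if_then_else_)
open import Data.Empty using (⊥-elim)
open import Data.Sum using (_⊎_; inj₁; inj₂)
open import Data.Product using (_×_; Σ-syntax; _,_)
open import Relation.Binary.PropositionalEquality as ≡ using (_≡_)
open import Relation.Nullary using (¬_; yes; no)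
open import Relation.Nullary.Decidable using (⌊_⌋)
open import Relation.Unary using (Decidable)
open import Relation.Binary.Bundles using (Poset)
open import Relation.Binary.Structures using (IsTotalOrder)
import Algebra.Properties.Ring as RingProperties
import Algebra.Solver.Ring.NaturalCoefficients.Default as NaturalSolver
import Relation.Binary.Reasoning.PartialOrder as PartialOrderReasoning

module _ {c ℓ₁ ℓ₂} (R : OrderedCommutativeRing c ℓ₁ ℓ₂) where
  open OrderedCommutativeRing R
  open Matrices R
  open RingProperties ring using (-‿involutive; -‿+-comm; -‿distribˡ-*; -‿distribʳ-*; x[y-z]≈xy-xz; -0#≈0#)
  private
    module O = IsTotalOrder isTotalOrder
    poset : Poset c ℓ₁ ℓ₂
    poset = record { isPartialOrder = O.isPartialOrder }
  open NaturalSolver commutativeSemiring using (solve; _:=_; _:+_; _:*_; con)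
  open PartialOrderReasoning poset

  -- Defs gives the field _≤_ no fixity, so it would bind tighter than _+_ and _*_.
  infix 4 _⊑_
  _⊑_ : Carrier → Carrier → Set ℓ₂
  _⊑_ = _≤_

  +-mono-≤₂ : ∀ {a b c d} → a ⊑ b → c ⊑ d → a + c ⊑ b + d
  +-mono-≤₂ {a} {b} {c} {d} a≤b c≤d = begin
    a + c ≤⟨ +-mono-≤ c a≤b ⟩
    b + c ≈⟨ +-comm b c ⟩
    c + b ≤⟨ +-mono-≤ b c≤d ⟩
    d + b ≈⟨ +-comm d b ⟩
    b + d ∎

  +-nonneg : ∀ {a b} → 0# ⊑ a → 0# ⊑ b → 0# ⊑ a + b
  +-nonneg 0≤a 0≤b = O.≤-respˡ-≈ (+-identityʳ 0#) (+-mono-≤₂ 0≤a 0≤b)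

  x≤x+y : ∀ {x y} → 0# ⊑ y → x ⊑ x + y
  x≤x+y {x} 0≤y = O.≤-respˡ-≈ (+-identityʳ x) (+-mono-≤₂ O.refl 0≤y)

  x≤y+x : ∀ {x y} → 0# ⊑ y → x ⊑ y + x
  x≤y+x {x} {y} 0≤y = O.≤-respʳ-≈ (+-comm x y) (x≤x+y 0≤y)

  x≤y⇒0≤y-x : ∀ {x y} → x ⊑ y → 0# ⊑ y - x
  x≤y⇒0≤y-x {x} {y} x≤y = begin
    0#    ≈⟨ sym (-‿inverseʳ x) ⟩
    x - x ≤⟨ +-mono-≤ (- x) x≤y ⟩
    y - x ∎

  x-y+y≈x : ∀ x y → (x - y) + y ≈ x
  x-y+y≈x x y = trans (+-assoc x (- y) y) (trans (+-congˡ (-‿inverseˡ y)) (+-identityʳ x))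

  0≤y-x⇒x≤y : ∀ {x y} → 0# ⊑ y - x → x ⊑ y
  0≤y-x⇒x≤y {x} {y} 0≤y-x = begin
    x           ≈⟨ sym (+-identityˡ x) ⟩
    0# + x      ≤⟨ +-mono-≤ x 0≤y-x ⟩
    (y - x) + x ≈⟨ x-y+y≈x y x ⟩
    y           ∎

  *-monoˡ-≤-nonneg : ∀ {c a b} → 0# ⊑ c → a ⊑ b → c * a ⊑ c * b
  *-monoˡ-≤-nonneg {c} {a} {b} 0≤c a≤b =
    0≤y-x⇒x≤y (O.≤-respʳ-≈ (x[y-z]≈xy-xz c b a) (*-nonneg 0≤c (x≤y⇒0≤y-x a≤b)))

  -x*-x≈x*x : ∀ x → (- x) * (- x) ≈ x * x
  -x*-x≈x*x x = begin-equality
    (- x) * (- x) ≈⟨ sym (-‿distribˡ-* x (- x)) ⟩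
    - (x * - x)   ≈⟨ -‿cong (sym (-‿distribʳ-* x x)) ⟩
    - (- (x * x)) ≈⟨ -‿involutive (x * x) ⟩
    x * x         ∎

  0≤x*x : ∀ x → 0# ⊑ x * x
  0≤x*x x with O.total 0# x
  ... | inj₁ 0≤x = *-nonneg 0≤x 0≤x
  ... | inj₂ x≤0 = O.≤-respʳ-≈ (-x*-x≈x*x x) (*-nonneg 0≤-x 0≤-x)
    where
    0≤-x : 0# ⊑ - x
    0≤-x = O.≤-respʳ-≈ (+-identityˡ (- x)) (x≤y⇒0≤y-x x≤0)

  xy+xy≤xx+yy : ∀ x y → x * y + x * y ⊑ x * x + y * y
  xy+xy≤xx+yy x y = begin
    x * y + x * y                         ≤⟨ x≤y+x (0≤x*x d) ⟩
    d * d + (x * y + x * y)               ≈⟨ +-congˡ (+-cong (*-congʳ (sym d+y≈x)) (*-congʳ (sym d+y≈x))) ⟩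
    d * d + ((d + y) * y + (d + y) * y)   ≈⟨ solve 2 (λ d y → d :* d :+ ((d :+ y) :* y :+ (d :+ y) :* y) := (d :+ y) :* (d :+ y) :+ y :* y) refl d y ⟩
    (d + y) * (d + y) + y * y             ≈⟨ +-congʳ (*-cong d+y≈x d+y≈x) ⟩
    x * x + y * y                         ∎
    where
    d = x - y
    d+y≈x : d + y ≈ x
    d+y≈x = x-y+y≈x x y

  ℕ→R-nonneg : ∀ k → 0# ⊑ ℕ→R k
  ℕ→R-nonneg ℕ.zero    = O.refl
  ℕ→R-nonneg (ℕ.suc k) = +-nonneg (O.≤-respʳ-≈ (*-identityˡ 1#) (0≤x*x 1#)) (ℕ→R-nonneg k)

  ℕ→R-+ : ∀ a b → ℕ→R (a ℕ.+ b) ≈ ℕ→R a + ℕ→R b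
  ℕ→R-+ ℕ.zero    b = sym (+-identityˡ _)
  ℕ→R-+ (ℕ.suc a) b = trans (+-congˡ (ℕ→R-+ a b)) (sym (+-assoc _ _ _))

  ℕ→R-* : ∀ a b → ℕ→R (a ℕ.* b) ≈ ℕ→R a * ℕ→R b
  ℕ→R-* ℕ.zero    b = sym (zeroˡ _)
  ℕ→R-* (ℕ.suc a) b = begin-equality
    ℕ→R (b ℕ.+ a ℕ.* b)     ≈⟨ ℕ→R-+ b (a ℕ.* b) ⟩
    ℕ→R b + ℕ→R (a ℕ.* b)   ≈⟨ +-congˡ (ℕ→R-* a b) ⟩
    ℕ→R b + ℕ→R a * ℕ→R b   ≈⟨ solve 2 (λ a b → b :+ a :* b := (con 1 :+ a) :* b) refl (ℕ→R a) (ℕ→R b) ⟩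
    (1# + ℕ→R a) * ℕ→R b    ∎

  ℕ→R-*-monoˡ-≤ : ∀ {a b T} → a ℕ.≤ b → 0# ⊑ T → ℕ→R a * T ⊑ ℕ→R b * T
  ℕ→R-*-monoˡ-≤ {a} {b} {T} a≤b 0≤T = begin
    ℕ→R a * T                         ≤⟨ x≤x+y (*-nonneg (ℕ→R-nonneg (b ℕ.∸ a)) 0≤T) ⟩
    ℕ→R a * T + ℕ→R (b ℕ.∸ a) * T     ≈⟨ sym (distribʳ T _ _) ⟩
    (ℕ→R a + ℕ→R (b ℕ.∸ a)) * T       ≈⟨ *-congʳ (sym (ℕ→R-+ a (b ℕ.∸ a))) ⟩
    ℕ→R (a ℕ.+ (b ℕ.∸ a)) * T         ≡⟨ ≡.cong (λ k → ℕ→R k * T) (ℕ.m+[n∸m]≡n a≤b) ⟩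
    ℕ→R b * T                         ∎

  ℕ→R-square-*-monoˡ-≤ : ∀ {a b T} → a ℕ.≤ b → 0# ⊑ T → ℕ→R a * ℕ→R a * T ⊑ ℕ→R b * ℕ→R b * T
  ℕ→R-square-*-monoˡ-≤ {a} {b} {T} a≤b 0≤T = begin
    ℕ→R a * ℕ→R a * T   ≈⟨ *-congʳ (sym (ℕ→R-* a a)) ⟩
    ℕ→R (a ℕ.* a) * T   ≤⟨ ℕ→R-*-monoˡ-≤ (ℕ.*-mono-≤ a≤b a≤b) 0≤T ⟩
    ℕ→R (b ℕ.* b) * T   ≈⟨ *-congʳ (ℕ→R-* b b) ⟩
    ℕ→R b * ℕ→R b * T   ∎

  x≤[1+k]²x : ∀ k {x} → 0# ⊑ x → x ⊑ ℕ→R (ℕ.suc k) * ℕ→R (ℕ.suc k) * x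
  x≤[1+k]²x k {x} 0≤x = begin
    x                                   ≈⟨ solve 1 (λ x → x := (con 1 :+ con 0) :* (con 1 :+ con 0) :* x) refl x ⟩
    ℕ→R 1 * ℕ→R 1 * x                   ≤⟨ ℕ→R-square-*-monoˡ-≤ {1} {ℕ.suc k} (ℕ.s≤s ℕ.z≤n) 0≤x ⟩
    ℕ→R (ℕ.suc k) * ℕ→R (ℕ.suc k) * x   ∎

  -- If x ≤ 0 then (1 + k) x = x + k x ≤ x, so (1 + k) x ≥ 0 forces x ≥ 0.
  ℕ→R-suc-*-nonneg⇒nonneg : ∀ k {x} → 0# ⊑ ℕ→R (ℕ.suc k) * x → 0# ⊑ x
  ℕ→R-suc-*-nonneg⇒nonneg k {x} 0≤[1+k]x with O.total 0# x
  ... | inj₁ 0≤x = 0≤x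
  ... | inj₂ x≤0 = begin
    0#                  ≤⟨ 0≤[1+k]x ⟩
    (1# + K) * x        ≈⟨ distribʳ x 1# K ⟩
    1# * x + K * x      ≤⟨ +-mono-≤₂ O.refl (*-monoˡ-≤-nonneg (ℕ→R-nonneg k) x≤0) ⟩
    1# * x + K * 0#     ≈⟨ solve 2 (λ x K → con 1 :* x :+ K :* con 0 := x) refl x K ⟩
    x                   ∎
    where K = ℕ→R k

  ℕ→R-suc-*-cancelˡ-≤ : ∀ k {y z} → ℕ→R (ℕ.suc k) * y ⊑ ℕ→R (ℕ.suc k) * z → y ⊑ z
  ℕ→R-suc-*-cancelˡ-≤ k {y} {z} ky≤kz = 0≤y-x⇒x≤y (ℕ→R-suc-*-nonneg⇒nonneg k
    (O.≤-respʳ-≈ (sym (x[y-z]≈xy-xz _ z y)) (x≤y⇒0≤y-x ky≤kz)))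

  -- Multiply by K = 1 + m, bound 2 (K a) b by (K a)² + b², and cancel K again.
  square-of-sum-≤ : ∀ m {a b T} → a * a ⊑ T → b * b ⊑ ℕ→R (ℕ.suc m) * ℕ→R (ℕ.suc m) * T →
                    (a + b) * (a + b) ⊑ ℕ→R (ℕ.suc (ℕ.suc m)) * ℕ→R (ℕ.suc (ℕ.suc m)) * T
  square-of-sum-≤ m {a} {b} {T} a²≤T b²≤K²T = ℕ→R-suc-*-cancelˡ-≤ m (begin
    K * ((a + b) * (a + b))
      ≈⟨ solve 3 (λ K a b → K :* ((a :+ b) :* (a :+ b)) := K :* (a :* a) :+ K :* (b :* b) :+ (K :* a :* b :+ K :* a :* b)) refl K a b ⟩
    K * (a * a) + K * (b * b) + (K * a * b + K * a * b)
      ≤⟨ +-mono-≤₂ O.refl (xy+xy≤xx+yy (K * a) b) ⟩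
    K * (a * a) + K * (b * b) + (K * a * (K * a) + b * b)
      ≈⟨ +-congˡ (+-congʳ (solve 2 (λ K a → K :* a :* (K :* a) := K :* K :* (a :* a)) refl K a)) ⟩
    K * (a * a) + K * (b * b) + (K * K * (a * a) + b * b)
      ≤⟨ +-mono-≤₂ (+-mono-≤₂ (*-monoˡ-≤-nonneg 0≤K a²≤T) (*-monoˡ-≤-nonneg 0≤K b²≤K²T))
                   (+-mono-≤₂ (*-monoˡ-≤-nonneg (*-nonneg 0≤K 0≤K) a²≤T) b²≤K²T) ⟩
    K * T + K * (K * K * T) + (K * K * T + K * K * T)
      ≈⟨ solve 2 (λ K T → K :* T :+ K :* (K :* K :* T) :+ (K :* K :* T :+ K :* K :* T) := K :* ((con 1 :+ K) :* (con 1 :+ K) :* T)) refl K T ⟩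
    K * ((1# + K) * (1# + K) * T) ∎)
    where
    K = ℕ→R (ℕ.suc m)
    0≤K = ℕ→R-nonneg (ℕ.suc m)

  ∑-cong : ∀ {n} {f g : Fin n → Carrier} → (∀ i → f i ≈ g i) → ∑ f ≈ ∑ g
  ∑-cong {ℕ.zero}  f≈g = refl
  ∑-cong {ℕ.suc n} f≈g = +-cong (f≈g fz) (∑-cong (λ i → f≈g (fs i)))

  ∑-mono-≤ : ∀ {n} {f g : Fin n → Carrier} → (∀ i → f i ⊑ g i) → ∑ f ⊑ ∑ g
  ∑-mono-≤ {ℕ.zero}  f≤g = O.refl
  ∑-mono-≤ {ℕ.suc n} f≤g = +-mono-≤₂ (f≤g fz) (∑-mono-≤ (λ i → f≤g (fs i)))

  ∑-nonneg : ∀ {n} {f : Fin n → Carrier} → (∀ i → 0# ⊑ f i) → 0# ⊑ ∑ f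
  ∑-nonneg {ℕ.zero}  0≤f = O.refl
  ∑-nonneg {ℕ.suc n} 0≤f = +-nonneg (0≤f fz) (∑-nonneg (λ i → 0≤f (fs i)))

  ∑-const : ∀ n x → ∑ {n} (λ _ → x) ≈ ℕ→R n * x
  ∑-const ℕ.zero    x = sym (zeroˡ x)
  ∑-const (ℕ.suc n) x = trans (+-cong (sym (*-identityˡ x)) (∑-const n x)) (sym (distribʳ x 1# (ℕ→R n)))

  ∑-zero : ∀ n → ∑ {n} (λ _ → 0#) ≈ 0#
  ∑-zero n = trans (∑-const n 0#) (zeroʳ (ℕ→R n))

  term≤∑ : ∀ {n} {f : Fin n → Carrier} → (∀ i → 0# ⊑ f i) → ∀ i → f i ⊑ ∑ f
  term≤∑ {ℕ.suc n} 0≤f fz     = x≤x+y (∑-nonneg (λ i → 0≤f (fs i)))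
  term≤∑ {ℕ.suc n} 0≤f (fs i) = O.trans (term≤∑ (λ i → 0≤f (fs i)) i) (x≤y+x (0≤f fz))

  frob²-nonneg : ∀ {n} (A : Mat n) → 0# ⊑ frob² A
  frob²-nonneg A = ∑-nonneg (λ i → ∑-nonneg (λ j → 0≤x*x (A i j)))

  entry²≤frob² : ∀ {n} (A : Mat n) i j → A i j * A i j ⊑ frob² A
  entry²≤frob² A i j = O.trans (term≤∑ (λ j → 0≤x*x (A i j)) j)
                              (term≤∑ (λ i → ∑-nonneg (λ j → 0≤x*x (A i j))) i)

  ℕ→R-^4 : ∀ n → ℕ→R (n ^ 4) ≈ ℕ→R n * (ℕ→R n * (ℕ→R n * ℕ→R n))
  ℕ→R-^4 n = begin-equality
    ℕ→R (n ^ 4)                                ≡⟨ ≡.cong (λ k → ℕ→R (n ℕ.* (n ℕ.* (n ℕ.* k)))) (ℕ.*-identityʳ n) ⟩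
    ℕ→R (n ℕ.* (n ℕ.* (n ℕ.* n)))              ≈⟨ ℕ→R-* n _ ⟩
    ℕ→R n * ℕ→R (n ℕ.* (n ℕ.* n))              ≈⟨ *-congˡ (trans (ℕ→R-* n _) (*-congˡ (ℕ→R-* n n))) ⟩
    ℕ→R n * (ℕ→R n * (ℕ→R n * ℕ→R n))          ∎

  frob²≤n⁴ : ∀ {n} (A : Mat n) T → (∀ i j → A i j * A i j ⊑ ℕ→R n * ℕ→R n * T) →
             frob² A ⊑ ℕ→R (n ^ 4) * T
  frob²≤n⁴ {n} A T entry²≤n²T = begin
    frob² A                                      ≤⟨ ∑-mono-≤ (λ i → ∑-mono-≤ (λ j → entry²≤n²T i j)) ⟩
    ∑ {n} (λ _ → ∑ {n} (λ _ → N * N * T))        ≈⟨ ∑-cong {n} (λ _ → ∑-const n (N * N * T)) ⟩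
    ∑ {n} (λ _ → N * (N * N * T))                ≈⟨ ∑-const n (N * (N * N * T)) ⟩
    N * (N * (N * N * T))                        ≈⟨ solve 2 (λ N T → N :* (N :* (N :* N :* T)) := N :* (N :* (N :* N)) :* T) refl N T ⟩
    N * (N * (N * N)) * T                        ≈⟨ *-congʳ (sym (ℕ→R-^4 n)) ⟩
    ℕ→R (n ^ 4) * T                              ∎
    where N = ℕ→R n

  FrobeniusBounds : ∀ {n} → Mat n → Mat n → Set ℓ₂
  FrobeniusBounds {n} D L = (frob² D ⊑ ℕ→R (n ^ 4) * frob² L) × (frob² L ⊑ ℕ→R (n ^ 4) * frob² D)

  -- The entrywise shape of L = D − Δ D Δᵀ, with μ ranking the rows along the shift.
  RankedDifference : ∀ {n} → (Fin n → ℕ) → Mat n → Mat n → Set ℓ₁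
  RankedDifference {n} μ D L = ∀ i j →
    L i j ≈ D i j ⊎ Σ[ i' ∈ Fin n ] Σ[ j' ∈ Fin n ] (μ i' <ℕ μ i × L i j ≈ D i j - D i' j')

  module _ {n} {μ : Fin n → ℕ} {D L : Mat n} (diff : RankedDifference μ D L) where

    rankedDifference-entry²-≤ : ∀ k i j → μ i ℕ.≤ k →
      D i j * D i j ⊑ ℕ→R (ℕ.suc k) * ℕ→R (ℕ.suc k) * frob² L
    rankedDifference-entry²-≤ k i j μi≤k with diff i j
    ... | inj₁ L≈D = O.trans (O.≤-respˡ-≈ (*-cong L≈D L≈D) (entry²≤frob² L i j)) (x≤[1+k]²x k (frob²-nonneg L))
    rankedDifference-entry²-≤ ℕ.zero i j μi≤0 | inj₂ (i' , j' , μi'<μi , _)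
      with () ← ℕ.≤-trans μi'<μi μi≤0
    rankedDifference-entry²-≤ (ℕ.suc k) i j μi≤1+k | inj₂ (i' , j' , μi'<μi , L≈D-D') =
      O.≤-respˡ-≈ (*-cong (sym D≈L+D') (sym D≈L+D'))
        (square-of-sum-≤ k (entry²≤frob² L i j)
          (rankedDifference-entry²-≤ k i' j' (ℕ.≤-pred (ℕ.≤-trans μi'<μi μi≤1+k))))
      where
      D≈L+D' : D i j ≈ L i j + D i' j'
      D≈L+D' = begin-equality
        D i j                       ≈⟨ sym (x-y+y≈x (D i j) (D i' j')) ⟩
        (D i j - D i' j') + D i' j' ≈⟨ +-congʳ (sym L≈D-D') ⟩
        L i j + D i' j'             ∎

    rankedDifference-frob²-lower : (∀ i → μ i <ℕ n) → frob² D ⊑ ℕ→R (n ^ 4) * frob² L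
    rankedDifference-frob²-lower μ<n = frob²≤n⁴ D (frob² L) λ i j →
      O.trans (rankedDifference-entry²-≤ (μ i) i j ℕ.≤-refl)
              (ℕ→R-square-*-monoˡ-≤ (μ<n i) (frob²-nonneg L))

    -- A subtracted entry needs two distinct ranks below n, hence n ≥ 2.
    rankedDifference-frob²-upper : (∀ i → μ i <ℕ n) → frob² L ⊑ ℕ→R (n ^ 4) * frob² D
    rankedDifference-frob²-upper μ<n = frob²≤n⁴ L (frob² D) entry²-≤
      where
      entry²-≤ : ∀ i j → L i j * L i j ⊑ ℕ→R n * ℕ→R n * frob² D
      entry²-≤ i j with diff i j
      ... | inj₁ L≈D = begin
        L i j * L i j          ≈⟨ *-cong L≈D L≈D ⟩
        D i j * D i j          ≤⟨ entry²≤frob² D i j ⟩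
        frob² D                ≤⟨ x≤[1+k]²x 0 (frob²-nonneg D) ⟩
        ℕ→R 1 * ℕ→R 1 * frob² D ≤⟨ ℕ→R-square-*-monoˡ-≤ (ℕ.≤-trans (ℕ.s≤s ℕ.z≤n) (μ<n i)) (frob²-nonneg D) ⟩
        ℕ→R n * ℕ→R n * frob² D ∎
      ... | inj₂ (i' , j' , μi'<μi , L≈D-D') = begin
        L i j * L i j                    ≈⟨ *-cong L≈D-D' L≈D-D' ⟩
        (D i j - D i' j') * (D i j - D i' j')
          ≤⟨ square-of-sum-≤ 0 (entry²≤frob² D i j)
               (O.trans (O.≤-respˡ-≈ (sym (-x*-x≈x*x _)) (entry²≤frob² D i' j')) (x≤[1+k]²x 0 (frob²-nonneg D))) ⟩
        ℕ→R 2 * ℕ→R 2 * frob² D          ≤⟨ ℕ→R-square-*-monoˡ-≤ 2≤n (frob²-nonneg D) ⟩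
        ℕ→R n * ℕ→R n * frob² D          ∎
        where
        2≤n : 2 ℕ.≤ n
        2≤n = ℕ.≤-trans (ℕ.s≤s (ℕ.≤-trans (ℕ.s≤s ℕ.z≤n) μi'<μi)) (μ<n i)

    rankedDifference-frobeniusBounds : (∀ i → μ i <ℕ n) → FrobeniusBounds D L
    rankedDifference-frobeniusBounds μ<n = rankedDifference-frob²-lower μ<n , rankedDifference-frob²-upper μ<n

  Picks : ∀ {n} → (Fin n → Carrier) → (Fin n → Set) → Set (c ⊔ ℓ₁)
  Picks {n} v P = (∀ (f : Fin n → Carrier) → ∑ (λ l → v l * f l) ≈ 0#)
                ⊎ Σ[ k ∈ Fin n ] (P k × ∀ (f : Fin n → Carrier) → ∑ (λ l → v l * f l) ≈ f k)

  indicator : ∀ {n} {P : Fin n → Set} → Decidable P → Fin n → Carrier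
  indicator P? k = if ⌊ P? k ⌋ then 1# else 0#

  indicator-none : ∀ {n} {P : Fin n → Set} (P? : Decidable P) → (∀ k → ¬ P k) →
                   ∀ (f : Fin n → Carrier) → ∑ (λ l → indicator P? l * f l) ≈ 0#
  indicator-none {ℕ.zero}  P? ¬P f = refl
  indicator-none {ℕ.suc n} P? ¬P f with P? fz
  ... | yes P0 = ⊥-elim (¬P fz P0)
  ... | no  _  = trans (+-cong (zeroˡ (f fz)) (indicator-none (λ k → P? (fs k)) (λ k → ¬P (fs k)) (λ k → f (fs k))))
                       (+-identityʳ 0#)

  indicator-picks : ∀ {n} {P : Fin n → Set} (P? : Decidable P) → (∀ {k k'} → P k → P k' → k ≡ k') →
                    Picks (indicator P?) P
  indicator-picks {ℕ.zero}  P? unique = inj₁ (λ f → refl)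
  indicator-picks {ℕ.suc n} P? unique with P? fz
  ... | yes P0 = inj₂ (fz , P0 , λ f → begin-equality
    1# * f fz + ∑ (λ l → indicator (λ k → P? (fs k)) l * f (fs l))
      ≈⟨ +-cong (*-identityˡ (f fz)) (indicator-none (λ k → P? (fs k)) (λ k Pk → Fin.0≢1+n (unique P0 Pk)) (λ k → f (fs k))) ⟩
    f fz + 0# ≈⟨ +-identityʳ (f fz) ⟩
    f fz      ∎)
  ... | no  _ with indicator-picks (λ k → P? (fs k)) (λ Pk Pk' → Fin.suc-injective (unique Pk Pk'))
  ...   | inj₁ none = inj₁ (λ f → trans (+-cong (zeroˡ (f fz)) (none (λ k → f (fs k)))) (+-identityʳ 0#))
  ...   | inj₂ (k , Pk , picked) = inj₂ (fs k , Pk , λ f →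
    trans (+-cong (zeroˡ (f fz)) (picked (λ k → f (fs k)))) (+-identityˡ (f (fs k))))

  conjugate-picked-row : ∀ {n} (A : Mat n) i j i' → (∀ (f : Fin n → Carrier) → ∑ (λ l → A i l * f l) ≈ f i') →
                         ∀ X → ((A ⊗ X) ⊗ transpose A) i j ≈ ∑ (λ l → A j l * X i' l)
  conjugate-picked-row A i j i' pick X =
    ∑-cong (λ l → trans (*-congʳ (pick (λ k → X k l))) (*-comm (X i' l) (A j l)))

  EntryShift : ∀ {n} → (Mat n → Mat n) → (Fin n → Fin n → Set) → Fin n → Fin n → Set (c ⊔ ℓ₁)
  EntryShift {n} Q P i j = (∀ X → Q X i j ≈ 0#)
                         ⊎ Σ[ i' ∈ Fin n ] Σ[ j' ∈ Fin n ] (P i i' × ∀ X → Q X i j ≈ X i' j')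

  conjugate-entryShift : ∀ {n} (A : Mat n) {P : Fin n → Fin n → Set} → (∀ i → Picks (A i) (P i)) →
                         ∀ i j → EntryShift (λ X → (A ⊗ X) ⊗ transpose A) P i j
  conjugate-entryShift {n} A rows i j with rows i | rows j
  ... | inj₁ noneᵢ | _ = inj₁ λ X → begin-equality
    ∑ (λ l → ∑ (λ k → A i k * X k l) * A j l) ≈⟨ ∑-cong (λ l → trans (*-congʳ (noneᵢ (λ k → X k l))) (zeroˡ (A j l))) ⟩
    ∑ {n} (λ _ → 0#)                          ≈⟨ ∑-zero n ⟩
    0#                                        ∎
  ... | inj₂ (i' , _ , pickᵢ) | inj₁ noneⱼ =
    inj₁ λ X → trans (conjugate-picked-row A i j i' pickᵢ X) (noneⱼ (X i'))
  ... | inj₂ (i' , Pii' , pickᵢ) | inj₂ (j' , _ , pickⱼ) =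
    inj₂ (i' , j' , Pii' , λ X → trans (conjugate-picked-row A i j i' pickᵢ X) (pickⱼ (X i')))

  [a-b]-[c-d]≈[a-c]-[b-d] : ∀ a b c d → (a - b) - (c - d) ≈ (a - c) - (b - d)
  [a-b]-[c-d]≈[a-c]-[b-d] a b c d = begin-equality
    (a + - b) + - (c + - d) ≈⟨ +-congˡ (-x-y≈-x+y c d) ⟩
    (a + - b) + (- c + d)   ≈⟨ solve 4 (λ a -b -c d → (a :+ -b) :+ (-c :+ d) := (a :+ -c) :+ (-b :+ d)) refl a (- b) (- c) d ⟩
    (a + - c) + (- b + d)   ≈⟨ +-congˡ (sym (-x-y≈-x+y b d)) ⟩
    (a + - c) + - (b + - d) ∎
    where
    -x-y≈-x+y : ∀ x y → - (x - y) ≈ - x + y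
    -x-y≈-x+y x y = trans (sym (-‿+-comm x (- y))) (+-congˡ (-‿involutive y))

  entryShift⇒rankedDifference : ∀ {n} {Q : Mat n → Mat n} {P : Fin n → Fin n → Set} {μ : Fin n → ℕ} →
    (∀ {i i'} → P i i' → μ i' <ℕ μ i) → (∀ i j → EntryShift Q P i j) →
    ∀ M M̃ → RankedDifference μ (M ⊖ M̃) ((M ⊖ Q M) ⊖ (M̃ ⊖ Q M̃))
  entryShift⇒rankedDifference {Q = Q} μ-lowers shift M M̃ i j with shift i j
  ... | inj₁ vanishes = inj₁ (begin-equality
    (M i j - Q M i j) - (M̃ i j - Q M̃ i j) ≈⟨ [a-b]-[c-d]≈[a-c]-[b-d] _ _ _ _ ⟩
    (M i j - M̃ i j) - (Q M i j - Q M̃ i j) ≈⟨ +-congˡ (-‿cong (+-cong (vanishes M) (-‿cong (vanishes M̃)))) ⟩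
    (M i j - M̃ i j) - (0# - 0#)           ≈⟨ +-congˡ (trans (-‿cong (-‿inverseʳ 0#)) -0#≈0#) ⟩
    (M i j - M̃ i j) + 0#                  ≈⟨ +-identityʳ _ ⟩
    M i j - M̃ i j                         ∎)
  ... | inj₂ (i' , j' , Pii' , moves) = inj₂ (i' , j' , μ-lowers Pii' ,
    trans ([a-b]-[c-d]≈[a-c]-[b-d] _ _ _ _) (+-congˡ (-‿cong (+-cong (moves M) (-‿cong (moves M̃))))))

  Δ-row-picks : ∀ {n} s (i : Fin n) → Picks (Δ s i) (λ k → toℕ i ≡ toℕ k ℕ.+ s)
  Δ-row-picks s i = indicator-picks (λ k → toℕ i ℕ.≟ toℕ k ℕ.+ s)
    (λ e e' → Fin.toℕ-injective (ℕ.+-cancelʳ-≡ _ _ _ (≡.trans (≡.sym e) e')))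

  Δᵀ-row-picks : ∀ {n} s (i : Fin n) → Picks (transpose (Δ s) i) (λ k → toℕ k ≡ toℕ i ℕ.+ s)
  Δᵀ-row-picks s i = indicator-picks (λ k → toℕ k ℕ.≟ toℕ i ℕ.+ s)
    (λ e e' → Fin.toℕ-injective (≡.trans e (≡.sym e')))

  s⁺-frobeniusBounds : ∀ n s → 0 <ℕ s → (M M̃ : Mat n) → FrobeniusBounds (M ⊖ M̃) (s⁺ s M ⊖ s⁺ s M̃)
  s⁺-frobeniusBounds n s 0<s M M̃ = rankedDifference-frobeniusBounds diff Fin.toℕ<n
    where
    shift-lowers : ∀ {i i' : Fin n} → toℕ i ≡ toℕ i' ℕ.+ s → toℕ i' <ℕ toℕ i
    shift-lowers {i' = i'} e = ≡.subst (toℕ i' <ℕ_) (≡.sym e) (ℕ.m<m+n (toℕ i') 0<s)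
    diff = entryShift⇒rankedDifference shift-lowers (conjugate-entryShift (Δ s) (Δ-row-picks s)) M M̃

  s⁻-frobeniusBounds : ∀ n s → 0 <ℕ s → (M M̃ : Mat n) → FrobeniusBounds (M ⊖ M̃) (s⁻ s M ⊖ s⁻ s M̃)
  s⁻-frobeniusBounds n s 0<s M M̃ = rankedDifference-frobeniusBounds diff μ<n
    where
    μ : Fin n → ℕ
    μ i = n ℕ.∸ ℕ.suc (toℕ i)
    μ<n : ∀ i → μ i <ℕ n
    μ<n i = ℕ.∸-monoʳ-< (ℕ.s≤s ℕ.z≤n) (Fin.toℕ<n i)
    shift-lowers : ∀ {i i' : Fin n} → toℕ i' ≡ toℕ i ℕ.+ s → μ i' <ℕ μ i
    shift-lowers {i} {i'} e =
      ℕ.∸-monoʳ-< (ℕ.s≤s (≡.subst (toℕ i <ℕ_) (≡.sym e) (ℕ.m<m+n (toℕ i) 0<s))) (Fin.toℕ<n i')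
    diff = entryShift⇒rankedDifference shift-lowers (conjugate-entryShift (transpose (Δ s)) (Δᵀ-row-picks s)) M M̃

lemma6p5 : ∀ {c ℓ₁ ℓ₂} (R : OrderedCommutativeRing c ℓ₁ ℓ₂) →
    let open OrderedCommutativeRing R
        open Matrices R
    in ∀ (n s : ℕ) → 0 <ℕ s → (M M̃ : Mat n) →
       ((frob² (M ⊖ M̃) ≤ (ℕ→R (n ^ 4) * frob² (s⁺ s M ⊖ s⁺ s M̃)))
         × (frob² (s⁺ s M ⊖ s⁺ s M̃) ≤ (ℕ→R (n ^ 4) * frob² (M ⊖ M̃))))
       × ((frob² (M ⊖ M̃) ≤ (ℕ→R (n ^ 4) * frob² (s⁻ s M ⊖ s⁻ s M̃)))
         × (frob² (s⁻ s M ⊖ s⁻ s M̃) ≤ (ℕ→R (n ^ 4) * frob² (M ⊖ M̃))))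
lemma6p5 R n s 0<s M M̃ = s⁺-frobeniusBounds R n s 0<s M M̃ , s⁻-frobeniusBounds R n s 0<s M M̃
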